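{- Let $G=(V,E)$ be a directed acyclic graph with no active cycle, let $K\subseteq V$, and let $T: x_0\sim x_1\sim\cdots\sim x_n\sim x_{n+1}$ be a trail in $G$ with $x_1,\dots,x_n\in K$ that has the minimum number of nodes among all trails between $x_0$ and $x_{n+1}$ activated by the empty set whose interior nodes all lie in $K$. Then (i) $\mathrm{ch}(x_0)\cap\mathrm{ch}(x_{n+1})\subseteq\bigcap_{i=1}^{n}\mathrm{ch}(x_i)$, and (ii) for all $i=1,\dots,n$, $x_i\notin\mathrm{ch}(x_0)\cap\mathrm{ch}(x_{n+1})$.
   Context: Graphs are finite, simple, without loops; $\mathrm{ch}(v)$ denotes the set of children of $v$. A trail is a sequence of pairwise distinct nodes with consecutive nodes adjacent (arc in either direction). An interior node $v_j$ is a converging connection if $v_{j-1}\to v_j\leftarrow v_{j+1}$, otherwise serial or diverging. A trail is activated by the empty set iff it has no converging connection. $G$ contains an active cycle if there exist a node $v$, distinct parents $w,z$ of $v$, and a trail $w\sim y_1\sim\cdots\sim y_m\sim z$ with $m\ge1$ all of whose interior nodes are serial or diverging connections, such that the cycle $v,w,y_1,\dots,y_m,z$ has no arc of $G$ between two of its nodes that are not consecutive in this cyclic order. -}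

module Defs where

open import Data.Nat using (ℕ; zero; suc; _+_; _≤_)
open import Data.Bool using (Bool; T)
open import Data.Fin using (Fin; toℕ)
open import Data.Fin.Subset using (Subset; _∈_)
open import Data.List using (List; []; _∷_; _++_; length; lookup)
open import Data.List.Relation.Unary.All using (All)
open import Data.List.Relation.Unary.Unique.Propositional using (Unique)
open import Data.List.Relation.Unary.Linked using (Linked)
open import Data.List.Membership.Propositional using () renaming (_∈_ to _∈ₗ_; _∉_ to _∉ₗ_)
open import Data.Product using (_×_; Σ; ∃; ∃-syntax)
open import Data.Sum using (_⊎_)
open import Data.Unit using (⊤)
open import Data.Empty using (⊥)
open import Relation.Nullary using (¬_)
open import Relation.Binary.PropositionalEquality using (_≡_; _≢_)
open import Relation.Binary.Construct.Closure.Transitive using (TransClosure)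

-- No loops.  (Simplicity: an arc is either
-- present or not; antiparallel arcs are excluded by acyclicity.)
record Digraph : Set where
  field
    N       : ℕ
    arc     : Fin N → Fin N → Bool
    noLoops : ∀ v → ¬ T (arc v v)

module _ (G : Digraph) where
  open Digraph G

  V : Set
  V = Fin N

  _⇒_ : V → V → Set
  u ⇒ v = T (arc u v)

  Adj : V → V → Set
  Adj u v = u ⇒ v ⊎ v ⇒ u

  IsChild : V → V → Set
  IsChild c v = v ⇒ c

  Acyclic : Set
  Acyclic = ∀ v → ¬ TransClosure _⇒_ v v

  IsTrailList : List V → Set
  IsTrailList xs = Unique xs × Linked Adj xs

  trailNodes : V → List V → V → List V
  trailNodes a ms b = a ∷ (ms ++ (b ∷ []))

  IsTrail : V → List V → V → Set
  IsTrail a ms b = IsTrailList (trailNodes a ms b)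

  NoConverging : List V → Set
  NoConverging (p ∷ c ∷ q ∷ rest) =
    ¬ (p ⇒ c × q ⇒ c) × NoConverging (c ∷ q ∷ rest)
  NoConverging _ = ⊤

  -- a trail is activated by the empty set iff it has no converging connection
  ActivatedByEmpty : V → List V → V → Set
  ActivatedByEmpty a ms b = NoConverging (trailNodes a ms b)

  -- no arc between two nodes of the cyclic sequence C that are not
  -- consecutive in the cyclic order (positions i < j with j ≥ i+2, and
  -- not {i , j} = {0 , length C - 1})
  Chordless : List V → Set
  Chordless C = (i j : Fin (length C)) →
    suc (suc (toℕ i)) ≤ toℕ j →
    ¬ (toℕ i ≡ 0 × suc (toℕ j) ≡ length C) →
    ¬ Adj (lookup C i) (lookup C j)

  HasActiveCycle : Set
  HasActiveCycle =
    Σ V λ v → Σ V λ w → Σ V λ z → Σ (List V) λ ys →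
      w ⇒ v × z ⇒ v × w ≢ z × 1 ≤ length ys ×
      IsTrail w ys z × ActivatedByEmpty w ys z ×
      v ∉ₗ trailNodes w ys z ×
      Chordless (v ∷ trailNodes w ys z)

  GoodTrail : Subset N → V → List V → V → Set
  GoodTrail K a ms b =
    IsTrail a ms b × ActivatedByEmpty a ms b × All (_∈ K) ms

  MinimalGoodTrail : Subset N → V → List V → V → Set
  MinimalGoodTrail K a ms b =
    GoodTrail K a ms b ×
    (∀ ms′ → GoodTrail K a ms′ b → length ms ≤ length ms′)

{-# OPTIONS --safe #-}
-- Write the trail as f 0 ∼ f 1 ∼ ⋯ ∼ f (n + 1). With no converging node, every node reaches
-- f 0 or f (n + 1) along a directed path, so in a DAG a common child c of the two ends lies
-- strictly below every node of the trail: it is off the trail and parent of none of its nodes,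
-- which gives (ii). Minimality makes the trail chordless: a chord cuts out a shorter trail, and
-- a converging node where the cut is made would close a directed cycle. Finally, if two
-- consecutive parents of c along the trail were not neighbours on it, the stretch between them
-- closed up through c would be an active cycle; so every node is a parent of c, which is (i).
module Submission where

open import Defs
open import Data.Empty using (⊥-elim)
open import Data.Fin using (toℕ)
open import Data.Fin.Properties using (toℕ<n)
open import Data.Fin.Subset using (Subset; _∈_)
open import Data.List using (List; []; _∷_; length; applyUpTo)
open import Data.List.Properties using (length-applyUpTo; lookup-applyUpTo; applyUpTo-∷ʳ)
open import Data.List.Membership.Propositional using () renaming (_∈_ to _∈ₗ_; _∉_ to _∉ₗ_)
open import Data.List.Relation.Unary.All using (All)
import Data.List.Relation.Unary.All.Properties as All
import Data.List.Relation.Unary.Any.Properties as Any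
open import Data.List.Relation.Unary.AllPairs using (AllPairs; _∷_)
open import Data.List.Relation.Unary.Linked using (Linked; _∷_)
import Data.List.Relation.Unary.Linked.Properties as Linked
import Data.List.Relation.Unary.Unique.Propositional.Properties as Unique
open import Data.Nat
  using (ℕ; zero; suc; _+_; _≤_; _<_; z≤n; s≤s; s≤s⁻¹; _≤?_;
         _≤′_; ≤′-refl; ≤′-step; _≤‴_; ≤‴-refl; ≤‴-step)
open import Data.Nat.Properties
  using (≤-refl; ≤-trans; ≤-reflexive; <⇒≤; <⇒≱; n≤1+n; m≤m+n; m≤n⇒m≤1+n; m<n⇒m<1+n; ≤∧≢⇒<;
         m≤n⇒m<n∨m≡n; m≤n⇒∃[o]m+o≡n; <-trans; ≤-<-connex; <-cmp; m∸n+n≡m; +-monoˡ-≤; +-monoˡ-<;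
         suc-injective; ≤⇒≤′; ≤⇒≤‴; ≤‴⇒≤; +-commutativeSemigroup)
open import Algebra.Properties.CommutativeSemigroup +-commutativeSemigroup using (xy∙z≈xz∙y)
open import Data.Product using (_×_; _,_; ∃)
open import Data.Sum using (inj₁; inj₂)
open import Data.Unit using (tt)
open import Function using (_∘_)
open import Relation.Binary using (tri<; tri≈; tri>)
open import Relation.Binary.Construct.Closure.Transitive using (TransClosure; [_]; _∷_; _∷ʳ_)
open import Relation.Binary.PropositionalEquality
  using (_≡_; _≢_; refl; sym; trans; cong; subst; subst₂)
open import Relation.Nullary using (¬_; Dec; yes; no; contradiction)
open import Relation.Nullary.Decidable.Core using (T?)

minimal-witness : (P : ℕ → Set) → (∀ p → Dec (P p)) →
  ∀ {k} → P k → ∃ λ p → p ≤ k × P p × (∀ {q} → q < p → ¬ P q)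
minimal-witness P P? {zero} Pk = 0 , z≤n , Pk , λ ()
minimal-witness P P? {suc k} Pk with P? 0
... | yes P0 = 0 , z≤n , P0 , λ ()
... | no ¬P0 with minimal-witness (P ∘ suc) (P? ∘ suc) Pk
...   | p , p≤k , Pp , below =
        suc p , s≤s p≤k , Pp , λ { {zero} _ → ¬P0 ; {suc q} q<p → below (s≤s⁻¹ q<p) }

module _ {A : Set} where

  walk : A → List A → A → ℕ → A
  walk a ms       b zero    = a
  walk a []       b (suc p) = b
  walk a (m ∷ ms) b (suc p) = walk m ms b p

  applyUpTo-walk : ∀ a ms b → applyUpTo (walk a ms b ∘ suc) (length ms) ≡ ms
  applyUpTo-walk a []       b = refl
  applyUpTo-walk a (m ∷ ms) b = cong (m ∷_) (applyUpTo-walk m ms b)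

  walk-last : ∀ a ms b → walk a ms b (suc (length ms)) ≡ b
  walk-last a []       b = refl
  walk-last a (m ∷ ms) b = walk-last m ms b

  walk-elim : (P : A → List A → A → Set) →
    (∀ f n → P (f 0) (applyUpTo (f ∘ suc) n) (f (suc n))) → ∀ a ms b → P a ms b
  walk-elim P h a ms b =
    subst₂ (P a) (applyUpTo-walk a ms b) (walk-last a ms b) (h (walk a ms b) (length ms))

  _◂_ : A → (ℕ → A) → ℕ → A
  (x ◂ f) zero    = x
  (x ◂ f) (suc p) = f p

  AllPairs-applyUpTo⁻ : ∀ {R : A → A → Set} f n → AllPairs R (applyUpTo f n) →
    ∀ {i j} → i < j → j < n → R (f i) (f j)
  AllPairs-applyUpTo⁻ f (suc n) (Rf₀ ∷ _) {zero} {suc j} _ (s≤s j<n) = All.applyUpTo⁻ (f ∘ suc) n Rf₀ j<n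
  AllPairs-applyUpTo⁻ f (suc n) (_ ∷ Rf) {suc i} {suc j} (s≤s i<j) (s≤s j<n) =
    AllPairs-applyUpTo⁻ (f ∘ suc) n Rf i<j j<n

  Linked-applyUpTo⁻ : ∀ {R : A → A → Set} f n → Linked R (applyUpTo f n) →
    ∀ {i} → suc i < n → R (f i) (f (suc i))
  Linked-applyUpTo⁻ f (suc zero)    _        (s≤s ())
  Linked-applyUpTo⁻ f (suc (suc n)) (r ∷ _)  {zero}  _         = r
  Linked-applyUpTo⁻ f (suc (suc n)) (_ ∷ rs) {suc i} (s≤s i<n) = Linked-applyUpTo⁻ (f ∘ suc) (suc n) rs i<n

module Skip (a o : ℕ) where

  skip : ℕ → ℕ
  skip p with p ≤? a
  ... | yes _ = p
  ... | no  _ = suc (p + o)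

  skip-≤ : ∀ {p} → p ≤ a → skip p ≡ p
  skip-≤ {p} p≤a with p ≤? a
  ... | yes _   = refl
  ... | no  p≰a = contradiction p≤a p≰a

  skip-> : ∀ {p} → a < p → skip p ≡ suc (p + o)
  skip-> {p} a<p with p ≤? a
  ... | yes p≤a = contradiction p≤a (<⇒≱ a<p)
  ... | no  _   = refl

  skip-strict : ∀ {p q} → p < q → skip p < skip q
  skip-strict {p} {q} p<q with p ≤? a | q ≤? a
  ... | yes _   | yes _   = p<q
  ... | yes _   | no  _   = m≤n⇒m≤1+n (≤-trans p<q (m≤m+n q o))
  ... | no  p≰a | yes q≤a = contradiction (≤-trans (<⇒≤ p<q) q≤a) p≰a
  ... | no  _   | no  _   = s≤s (+-monoˡ-< o p<q)

  skip-bounded : ∀ {k p} → a ≤ k → p ≤ suc k → skip p ≤ suc (suc (k + o))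
  skip-bounded {k} {p} a≤k p≤k+1 with p ≤? a
  ... | yes p≤a = ≤-trans p≤a (≤-trans a≤k (≤-trans (m≤m+n k o) (≤-trans (n≤1+n _) (n≤1+n _))))
  ... | no  _   = s≤s (+-monoˡ-≤ o p≤k+1)

module _ (G : Digraph) where

  infix 4 _⟶_ _⟶⁺_

  _⟶_ : V G → V G → Set
  u ⟶ v = _⇒_ G u v

  _⟶⁺_ : V G → V G → Set
  _⟶⁺_ = TransClosure _⟶_

  Converging : V G → V G → V G → Set
  Converging u v w = u ⟶ v × w ⟶ v

  NoConverging-applyUpTo⁺ : ∀ f k → (∀ {i} → 2 + i < k → ¬ Converging (f i) (f (1 + i)) (f (2 + i))) →
    NoConverging G (applyUpTo f k)
  NoConverging-applyUpTo⁺ f 0 _ = tt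
  NoConverging-applyUpTo⁺ f 1 _ = tt
  NoConverging-applyUpTo⁺ f 2 _ = tt
  NoConverging-applyUpTo⁺ f (suc (suc (suc k))) nc =
    nc (s≤s (s≤s (s≤s z≤n))) , NoConverging-applyUpTo⁺ (f ∘ suc) (suc (suc k)) (nc ∘ s≤s)

  NoConverging-applyUpTo⁻ : ∀ f k → NoConverging G (applyUpTo f k) →
    ∀ {i} → 2 + i < k → ¬ Converging (f i) (f (1 + i)) (f (2 + i))
  NoConverging-applyUpTo⁻ f 1 _ (s≤s ())
  NoConverging-applyUpTo⁻ f 2 _ (s≤s (s≤s ()))
  NoConverging-applyUpTo⁻ f (suc (suc (suc k))) (nc₀ , nc) {zero}  _ = nc₀
  NoConverging-applyUpTo⁻ f (suc (suc (suc k))) (nc₀ , nc) {suc i} i+2<k =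
    NoConverging-applyUpTo⁻ (f ∘ suc) (suc (suc k)) nc (s≤s⁻¹ i+2<k)

  Chordless-applyUpTo⁺ : ∀ f k →
    (∀ {i j} → 2 + i ≤ j → j < k → ¬ (i ≡ 0 × suc j ≡ k) → ¬ Adj G (f i) (f j)) →
    Chordless G (applyUpTo f k)
  Chordless-applyUpTo⁺ f k noChord i j i+2≤j notEnds adj =
    noChord i+2≤j (subst (toℕ j <_) (length-applyUpTo f k) (toℕ<n j))
      (λ { (i≡0 , j+1≡k) → notEnds (i≡0 , trans j+1≡k (sym (length-applyUpTo f k))) })
      (subst₂ (Adj G) (lookup-applyUpTo f k i) (lookup-applyUpTo f k j) adj)

  record ActiveTrail (f : ℕ → V G) (n : ℕ) : Set where
    field
      injective : ∀ {i j} → i < j → j ≤ suc n → f i ≢ f j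
      adjacent  : ∀ {i} → i ≤ n → Adj G (f i) (f (suc i))
      unblocked : ∀ {i} → i < n → ¬ Converging (f i) (f (suc i)) (f (suc (suc i)))

  NoChord : (ℕ → V G) → ℕ → Set
  NoChord f n = ∀ {i j} → 2 + i ≤ j → j ≤ suc n → ¬ Adj G (f i) (f j)

  Shortest : Subset (Digraph.N G) → (ℕ → V G) → ℕ → Set
  Shortest K f n = ∀ {g k} → ActiveTrail g k → (∀ {p} → p < k → g (suc p) ∈ K) →
    g 0 ≡ f 0 → g (suc k) ≡ f (suc n) → n ≤ k

  trailNodes-applyUpTo : ∀ f n → trailNodes G (f 0) (applyUpTo (f ∘ suc) n) (f (suc n)) ≡ applyUpTo f (2 + n)
  trailNodes-applyUpTo f n = cong (f 0 ∷_) (applyUpTo-∷ʳ (f ∘ suc) n)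

  module _ {f : ℕ → V G} {n : ℕ} where

    ActiveTrail⇒IsTrail : ActiveTrail f n → IsTrail G (f 0) (applyUpTo (f ∘ suc) n) (f (suc n))
    ActiveTrail⇒IsTrail trail =
      subst (IsTrailList G) (sym (trailNodes-applyUpTo f n))
        ( Unique.applyUpTo⁺₁ f (2 + n) (λ i<j j<n+2 → injective i<j (s≤s⁻¹ j<n+2))
        , Linked.applyUpTo⁺₁ f (2 + n) (λ i<n+1 → adjacent (s≤s⁻¹ (s≤s⁻¹ i<n+1))) )
      where open ActiveTrail trail

    ActiveTrail⇒ActivatedByEmpty : ActiveTrail f n → ActivatedByEmpty G (f 0) (applyUpTo (f ∘ suc) n) (f (suc n))
    ActiveTrail⇒ActivatedByEmpty trail =
      subst (NoConverging G) (sym (trailNodes-applyUpTo f n))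
        (NoConverging-applyUpTo⁺ f (2 + n) (λ i+1<n+1 → unblocked (s≤s⁻¹ (s≤s⁻¹ i+1<n+1))))
      where open ActiveTrail trail

    trail⇒ActiveTrail : IsTrail G (f 0) (applyUpTo (f ∘ suc) n) (f (suc n)) →
      ActivatedByEmpty G (f 0) (applyUpTo (f ∘ suc) n) (f (suc n)) → ActiveTrail f n
    trail⇒ActiveTrail (unique , linked) activated = record
      { injective = λ i<j j≤n+1 → AllPairs-applyUpTo⁻ f (2 + n) distinctNodes i<j (s≤s j≤n+1)
      ; adjacent  = λ i≤n → Linked-applyUpTo⁻ f (2 + n) adjacentNodes (s≤s (s≤s i≤n))
      ; unblocked = λ i<n → NoConverging-applyUpTo⁻ f (2 + n) noConverging (s≤s (s≤s i<n))
      }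
      where
      distinctNodes : AllPairs _≢_ (applyUpTo f (2 + n))
      distinctNodes = subst (AllPairs _≢_) (trailNodes-applyUpTo f n) unique
      adjacentNodes : Linked (Adj G) (applyUpTo f (2 + n))
      adjacentNodes = subst (Linked (Adj G)) (trailNodes-applyUpTo f n) linked
      noConverging : NoConverging G (applyUpTo f (2 + n))
      noConverging = subst (NoConverging G) (trailNodes-applyUpTo f n) activated

    ActiveTrail-segment : ActiveTrail f n → ∀ {a m} → m + a ≤ n → ActiveTrail (λ p → f (p + a)) m
    ActiveTrail-segment trail {a} m+a≤n = record
      { injective = λ i<j j≤m+1 → injective (+-monoˡ-< a i<j) (≤-trans (+-monoˡ-≤ a j≤m+1) (s≤s m+a≤n))
      ; adjacent  = λ i≤m → adjacent (≤-trans (+-monoˡ-≤ a i≤m) m+a≤n)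
      ; unblocked = λ i<m → unblocked (≤-trans (+-monoˡ-< a i<m) m+a≤n)
      }
      where open ActiveTrail trail

    NoChord-segment : NoChord f n → ∀ {a m} → m + a ≤ n → NoChord (λ p → f (p + a)) m
    NoChord-segment noChord {a} m+a≤n i+2≤j j≤m+1 =
      noChord (+-monoˡ-≤ a i+2≤j) (≤-trans (+-monoˡ-≤ a j≤m+1) (s≤s m+a≤n))

  module _ {f : ℕ → V G} {n : ℕ} (trail : ActiveTrail f n) where
    open ActiveTrail trail

    forward-step : ∀ {i} → suc i ≤ n → f i ⟶ f (suc i) → f (suc i) ⟶ f (suc (suc i))
    forward-step i<n fwd with adjacent i<n
    ... | inj₁ fwd′ = fwd′
    ... | inj₂ bwd  = ⊥-elim (unblocked i<n (fwd , bwd))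

    backward-step : ∀ {i} → suc i ≤ n → f (suc (suc i)) ⟶ f (suc i) → f (suc i) ⟶ f i
    backward-step i<n bwd with adjacent (<⇒≤ i<n)
    ... | inj₁ fwd  = ⊥-elim (unblocked i<n (fwd , bwd))
    ... | inj₂ bwd′ = bwd′

    forward-path : ∀ {i j} → i ≤ j → j ≤ n → f i ⟶ f (suc i) → f i ⟶⁺ f (suc j)
    forward-path {j = j} i≤j j≤n = go (≤⇒≤‴ i≤j)
      where
      go : ∀ {i} → i ≤‴ j → f i ⟶ f (suc i) → f i ⟶⁺ f (suc j)
      go ≤‴-refl       fwd = [ fwd ]
      go (≤‴-step i<j) fwd = fwd ∷ go i<j (forward-step (≤-trans (≤‴⇒≤ i<j) j≤n) fwd)

    backward-path : ∀ {i j} → i ≤ j → j ≤ n → f (suc j) ⟶ f j → f (suc j) ⟶⁺ f i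
    backward-path {i} i≤j = go (≤⇒≤′ i≤j)
      where
      go : ∀ {j} → i ≤′ j → j ≤ n → f (suc j) ⟶ f j → f (suc j) ⟶⁺ f i
      go ≤′-refl       _   bwd = [ bwd ]
      go (≤′-step i≤j) j<n bwd = bwd ∷ go i≤j (<⇒≤ j<n) (backward-step j<n bwd)

    ancestor-of-common-child : ∀ {c} → f 0 ⟶ c → f (suc n) ⟶ c → ∀ {i} → i ≤ suc n → f i ⟶⁺ c
    ancestor-of-common-child h₀ h₁ {zero}  _ = [ h₀ ]
    ancestor-of-common-child h₀ h₁ {suc i} i<n+1 with adjacent (s≤s⁻¹ i<n+1)
    ... | inj₂ bwd = backward-path z≤n (s≤s⁻¹ i<n+1) bwd ∷ʳ h₀
    ... | inj₁ fwd with m≤n⇒m<n∨m≡n (s≤s⁻¹ i<n+1)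
    ...   | inj₁ i<n  = forward-path i<n ≤-refl (forward-step i<n fwd) ∷ʳ h₁
    ...   | inj₂ refl = [ h₁ ]

    module _ (acyclic : Acyclic G) where

      common-child-off-trail : ∀ {c} → f 0 ⟶ c → f (suc n) ⟶ c → ∀ {i} → i ≤ suc n → c ≢ f i
      common-child-off-trail h₀ h₁ i≤n+1 refl = acyclic _ (ancestor-of-common-child h₀ h₁ i≤n+1)

      common-child-not-parent : ∀ {c} → f 0 ⟶ c → f (suc n) ⟶ c → ∀ {i} → i ≤ suc n → ¬ c ⟶ f i
      common-child-not-parent h₀ h₁ i≤n+1 arc = acyclic _ (arc ∷ ancestor-of-common-child h₀ h₁ i≤n+1)

      unblocked-shortcutˡ : ∀ {i j} → suc i < j → j ≤ suc n → ¬ Converging (f i) (f (suc i)) (f j)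
      unblocked-shortcutˡ {i} {suc j} i+1<j+1 j<n+1 (fwd , into) =
        acyclic _ (forward-path i<j j≤n (forward-step (≤-trans i<j j≤n) fwd) ∷ʳ into)
        where
        i<j : suc i ≤ j
        i<j = s≤s⁻¹ i+1<j+1
        j≤n : j ≤ n
        j≤n = s≤s⁻¹ j<n+1

      unblocked-shortcutʳ : ∀ {i j} → i < j → j ≤ n → ¬ Converging (f i) (f j) (f (suc j))
      unblocked-shortcutʳ {i} {suc j} i<j+1 j<n (into , bwd) =
        acyclic _ (backward-path (s≤s⁻¹ i<j+1) (<⇒≤ j<n) (backward-step j<n bwd) ∷ʳ into)

      module _ {a o k : ℕ} (a≤k : a ≤ k) (k+o+1≡n : suc (k + o) ≡ n) where
        open Skip a o

        private
          k<n : k < n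
          k<n = ≤-trans (s≤s (m≤m+n k o)) (≤-reflexive k+o+1≡n)

          high-bound : ∀ {p} → p ≤ k → suc (p + o) ≤ n
          high-bound p≤k = ≤-trans (s≤s (+-monoˡ-≤ o p≤k)) (≤-reflexive k+o+1≡n)

          skip-bounded′ : ∀ {p} → p ≤ suc k → skip p ≤ suc n
          skip-bounded′ {p} p≤k+1 = subst (λ m → skip p ≤ suc m) k+o+1≡n (skip-bounded a≤k p≤k+1)

        -- f ∘ skip is f with the o + 1 nodes strictly between f a and f (a + o + 2) cut out.
        shortcut : Adj G (f a) (f (suc (suc (a + o)))) → ActiveTrail (f ∘ skip) k
        shortcut chord = record
          { injective = λ i<j j≤k+1 → injective (skip-strict i<j) (skip-bounded′ j≤k+1)
          ; adjacent  = adjacent′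
          ; unblocked = unblocked′
          }
          where
          adjacent′ : ∀ {p} → p ≤ k → Adj G (f (skip p)) (f (skip (suc p)))
          adjacent′ {p} p≤k with <-cmp p a
          ... | tri< p<a _ _ rewrite skip-≤ (<⇒≤ p<a) | skip-≤ p<a = adjacent (≤-trans p≤k (<⇒≤ k<n))
          ... | tri≈ _ refl _ rewrite skip-≤ (≤-refl {a}) | skip-> (≤-refl {suc a}) = chord
          ... | tri> _ _ a<p rewrite skip-> a<p | skip-> (m<n⇒m<1+n a<p) = adjacent (high-bound p≤k)

          unblocked′ : ∀ {p} → p < k → ¬ Converging (f (skip p)) (f (skip (suc p))) (f (skip (suc (suc p))))
          unblocked′ {p} p<k with <-cmp (suc p) a
          ... | tri< p+1<a _ _
                rewrite skip-≤ (<⇒≤ (<⇒≤ p+1<a)) | skip-≤ (<⇒≤ p+1<a) | skip-≤ p+1<a =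
                  unblocked (<-trans p<k k<n)
          ... | tri≈ _ refl _
                rewrite skip-≤ (n≤1+n p) | skip-≤ (≤-refl {suc p}) | skip-> (≤-refl {suc (suc p)}) =
                  unblocked-shortcutˡ (s≤s (s≤s (m≤n⇒m≤1+n (m≤m+n p o)))) (s≤s (high-bound p<k))
          ... | tri> _ _ a<p+1 with m≤n⇒m<n∨m≡n (s≤s⁻¹ a<p+1)
          ...   | inj₂ refl
                  rewrite skip-≤ (≤-refl {a}) | skip-> (≤-refl {suc a}) | skip-> (n≤1+n (suc a)) =
                    unblocked-shortcutʳ (s≤s (m≤n⇒m≤1+n (m≤m+n p o))) (high-bound p<k)
          ...   | inj₁ a<p
                  rewrite skip-> a<p | skip-> (m<n⇒m<1+n a<p) | skip-> (m<n⇒m<1+n (m<n⇒m<1+n a<p)) =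
                    unblocked (high-bound p<k)

        shortest⇒no-shortcut : ∀ {K} → (∀ {p} → p < n → f (suc p) ∈ K) → Shortest K f n →
          ¬ Adj G (f a) (f (suc (suc (a + o))))
        shortest⇒no-shortcut {K} inK shortest chord =
          <⇒≱ k<n (shortest (shortcut chord) interior (cong f (skip-≤ z≤n)) (cong f last))
          where
          last : skip (suc k) ≡ suc n
          last = trans (skip-> (s≤s a≤k)) (cong suc k+o+1≡n)

          interior : ∀ {p} → p < k → f (skip (suc p)) ∈ K
          interior {p} p<k with ≤-<-connex (suc p) a
          ... | inj₁ p<a rewrite skip-≤ p<a = inK (<-trans p<k k<n)
          ... | inj₂ a≤p rewrite skip-> a≤p = inK (high-bound p<k)

      shortest⇒NoChord : ∀ {K} → (∀ {p} → p < n → f (suc p) ∈ K) → Shortest K f n → NoChord f n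
      shortest⇒NoChord inK shortest {i} i+2≤j j≤n+1 with m≤n⇒∃[o]m+o≡n i+2≤j | m≤n⇒∃[o]m+o≡n j≤n+1
      ... | o , refl | r , j+r≡n+1 =
        shortest⇒no-shortcut (m≤m+n i r) (trans (cong suc (xy∙z≈xz∙y i r o)) (suc-injective j+r≡n+1))
          inK shortest

      active-cycle : NoChord f n → ∀ {c} → f 0 ⟶ c → f (suc n) ⟶ c →
        (∀ {i} → i < n → ¬ f (suc i) ⟶ c) → 1 ≤ n → HasActiveCycle G
      active-cycle noChord {c} h₀ h₁ interiorNotParent 1≤n =
        c , f 0 , f (suc n) , applyUpTo (f ∘ suc) n , h₀ , h₁ ,
        injective (s≤s z≤n) ≤-refl ,
        subst (1 ≤_) (sym (length-applyUpTo (f ∘ suc) n)) 1≤n ,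
        ActiveTrail⇒IsTrail trail , ActiveTrail⇒ActivatedByEmpty trail ,
        c∉trail ,
        subst (λ L → Chordless G (c ∷ L)) (sym (trailNodes-applyUpTo f n))
          (Chordless-applyUpTo⁺ (c ◂ f) (3 + n) cycle-noChord)
        where
        c∉trail : c ∉ₗ trailNodes G (f 0) (applyUpTo (f ∘ suc) n) (f (suc n))
        c∉trail c∈ with Any.applyUpTo⁻ f (subst (c ∈ₗ_) (trailNodes-applyUpTo f n) c∈)
        ... | i , i<n+2 , c≡fi = common-child-off-trail h₀ h₁ (s≤s⁻¹ i<n+2) c≡fi

        cycle-noChord : ∀ {i j} → 2 + i ≤ j → j < 3 + n → ¬ (i ≡ 0 × suc j ≡ 3 + n) →
          ¬ Adj G ((c ◂ f) i) ((c ◂ f) j)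
        cycle-noChord {zero} {suc zero} (s≤s ())
        cycle-noChord {zero} {suc (suc j)} _ j<n+1 notEnds (inj₁ c⟶fj) =
          common-child-not-parent h₀ h₁ (s≤s⁻¹ (s≤s⁻¹ j<n+1)) c⟶fj
        cycle-noChord {zero} {suc (suc j)} _ j<n+1 notEnds (inj₂ fj⟶c) =
          interiorNotParent (≤∧≢⇒< (s≤s⁻¹ (s≤s⁻¹ (s≤s⁻¹ j<n+1))) λ { refl → notEnds (refl , refl) }) fj⟶c
        cycle-noChord {suc i} {suc j} i+2≤j j<n+2 _ = noChord (s≤s⁻¹ i+2≤j) (s≤s⁻¹ (s≤s⁻¹ j<n+2))

  parent-of-common-child : Acyclic G → ¬ HasActiveCycle G → ∀ {f n} → ActiveTrail f n → NoChord f n →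
    ∀ {c} → f 0 ⟶ c → f (suc n) ⟶ c → ∀ {i} → i ≤ suc n → f i ⟶ c
  parent-of-common-child acyclic noActiveCycle {f} {n} trail noChord {c} h₀ h₁ = parent
    where
    next-parent : ∀ {i} → i ≤ n → f i ⟶ c → f (suc i) ⟶ c
    next-parent {i} i≤n hᵢ
      with minimal-witness (λ p → f (suc (p + i)) ⟶ c) (λ p → T? (Digraph.arc G (f (suc (p + i))) c))
             (subst (λ m → f (suc m) ⟶ c) (sym (m∸n+n≡m i≤n)) h₁)
    ... | zero  , _ , h , _ = h
    ... | suc m , m<n-i , h , none =
      ⊥-elim (noActiveCycle (active-cycle (ActiveTrail-segment trail bound) acyclic
                                          (NoChord-segment noChord bound) hᵢ h none (s≤s z≤n)))
      where
      bound : suc m + i ≤ n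
      bound = ≤-trans (+-monoˡ-≤ i m<n-i) (≤-reflexive (m∸n+n≡m i≤n))

    parent : ∀ {i} → i ≤ suc n → f i ⟶ c
    parent {zero}  _       = h₀
    parent {suc i} i<n+1 = next-parent (s≤s⁻¹ i<n+1) (parent (m≤n⇒m≤1+n (s≤s⁻¹ i<n+1)))

  minimal⇒Shortest : ∀ {K f n} →
    (∀ ms → GoodTrail G K (f 0) ms (f (suc n)) → length (applyUpTo (f ∘ suc) n) ≤ length ms) → Shortest K f n
  minimal⇒Shortest {K} {f} {n} minimal {g} {k} trail inK g₀≡f₀ gₖ₊₁≡fₙ₊₁ =
    subst₂ _≤_ (length-applyUpTo (f ∘ suc) n) (length-applyUpTo (g ∘ suc) k)
      (minimal ms (subst₂ (λ x y → GoodTrail G K x ms y) g₀≡f₀ gₖ₊₁≡fₙ₊₁ good))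
    where
    ms : List (V G)
    ms = applyUpTo (g ∘ suc) k
    good : GoodTrail G K (g 0) ms (g (suc k))
    good = ActiveTrail⇒IsTrail trail , ActiveTrail⇒ActivatedByEmpty trail , All.applyUpTo⁺₁ (g ∘ suc) k inK

corollary4p9 : (G : Digraph) → Acyclic G → ¬ HasActiveCycle G →
    (K : Subset (Digraph.N G)) (x₀ : V G) (xs : List (V G)) (xₙ₊₁ : V G) →
    MinimalGoodTrail G K x₀ xs xₙ₊₁ →
    ((c : V G) → IsChild G c x₀ → IsChild G c xₙ₊₁ → All (λ xᵢ → IsChild G c xᵢ) xs)
    × All (λ xᵢ → ¬ (IsChild G xᵢ x₀ × IsChild G xᵢ xₙ₊₁)) xs
corollary4p9 G acyclic noActiveCycle K = walk-elim _ λ where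
  f n ((isTrail , activated , allInK) , minimal) →
    let trail   = trail⇒ActiveTrail G {f} {n} isTrail activated
        inK     = All.applyUpTo⁻ (f ∘ suc) n allInK
        noChord = shortest⇒NoChord G trail acyclic inK (minimal⇒Shortest G {K} {f} {n} minimal)
    in (λ c h₀ h₁ → All.applyUpTo⁺₁ (f ∘ suc) n λ i<n →
          parent-of-common-child G acyclic noActiveCycle trail noChord h₀ h₁ (s≤s (<⇒≤ i<n)))
     , All.applyUpTo⁺₁ (f ∘ suc) n λ i<n (h₀ , h₁) →
          common-child-off-trail G trail acyclic h₀ h₁ (s≤s (<⇒≤ i<n)) refl
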